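{- For every positive integer $k$ there exists a real orthogonal $k\times k$ matrix $Q$ such that, for every subset $K\subseteq\{1,\dots,k\}$ with $K\neq\emptyset$ and $K\neq\{1,\dots,k\}$, every entry of the matrix $Q D_K Q^T$ is nonzero.
   Context: For $K\subseteq\{1,\dots,k\}$, $D_K$ denotes the $k\times k$ diagonal matrix with $(i,i)$ entry equal to $1$ if $i\in K$ and $0$ otherwise. -}

module Defs where

open import Level using (Level; 0ℓ; _⊔_) renaming (suc to lsuc)
open import Data.Nat using (ℕ; zero; suc)
open import Data.Fin using (Fin; zero; suc; _≟_)
open import Data.Fin.Subset using (Subset)
open import Data.Vec using (lookup)
open import Data.Bool using (true; false)
open import Data.Product using (Σ; ∃; _×_; _,_)
open import Relation.Nullary using (¬_; yes; no)
open import Relation.Binary.Structures using (IsTotalOrder)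
open import Algebra.Bundles using (CommutativeRing)

-- The real numbers, axiomatised as a complete ordered field
-- (unique up to isomorphism; ℝ is not available in agda-stdlib).
record RealField (c ℓ₁ ℓ₂ : Level) : Set (lsuc (c ⊔ ℓ₁ ⊔ ℓ₂)) where
  field
    cring : CommutativeRing c ℓ₁
  open CommutativeRing cring public
  field
    _≤_          : Carrier → Carrier → Set ℓ₂
    0≉1          : ¬ (0# ≈ 1#)
    inverse      : ∀ x → ¬ (x ≈ 0#) → Σ Carrier λ y → (x * y) ≈ 1#
    isTotalOrder : IsTotalOrder _≈_ _≤_
    +-mono-≤     : ∀ {x y} z → x ≤ y → (x + z) ≤ (y + z)
    *-nonneg     : ∀ {x y} → 0# ≤ x → 0# ≤ y → 0# ≤ (x * y)
    lub          : (P : Carrier → Set c) → Σ Carrier P →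
                   Σ Carrier (λ b → ∀ x → P x → x ≤ b) →
                   Σ Carrier λ s → (∀ x → P x → x ≤ s) ×
                                   (∀ b → (∀ x → P x → x ≤ b) → s ≤ b)

module Matrices {c ℓ₁ ℓ₂} (R : RealField c ℓ₁ ℓ₂) where
  open RealField R hiding (zero)

  Matrix : ℕ → Set c
  Matrix k = Fin k → Fin k → Carrier

  ∑ : ∀ {k} → (Fin k → Carrier) → Carrier
  ∑ {zero}  f = 0#
  ∑ {suc k} f = f zero + ∑ (λ i → f (suc i))

  _ᵀ : ∀ {k} → Matrix k → Matrix k
  (A ᵀ) i j = A j i

  _⊗_ : ∀ {k} → Matrix k → Matrix k → Matrix k
  (A ⊗ B) i j = ∑ (λ l → A i l * B l j)

  I : ∀ {k} → Matrix k
  I i j with i ≟ j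
  ... | yes _ = 1#
  ... | no  _ = 0#

  D : ∀ {k} → Subset k → Matrix k
  D K i j with i ≟ j | lookup K i
  ... | yes _ | true = 1#
  ... | _     | _    = 0#

  Orthogonal : ∀ {k} → Matrix k → Set ℓ₁
  Orthogonal Q = ∀ i j → ((Q ᵀ) ⊗ Q) i j ≈ I i j

-- Let a = (1, 2, …, 2), so that s = ‖a‖² = 4k - 3 is odd, and let Q = I - (2/s) a aᵀ be the
-- Householder reflection along a. With w = Σ_{l ∈ K} a_l², which satisfies 0 < w < s when
-- K ≠ ∅, {1, …, k}, one computes
--   s² (Q D_K Qᵀ)ᵢⱼ = s² [i = j ∈ K] - 2 s aᵢ aⱼ ([i ∈ K] + [j ∈ K]) + 4 aᵢ aⱼ w.
-- If i = j ∈ K this integer is odd. Otherwise it is 2 aᵢ aⱼ (2w - s n) with n ∈ {0, 1, 2}, and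
-- 2w ≠ s n because s is odd and 0 < w < s. An ordered field has characteristic zero, so the
-- entry itself is nonzero.
module Submission where

open import Defs
open import Level using (0ℓ)
open import Data.Nat using (ℕ; _≤_)
open import Data.Fin.Subset using (Subset; ⊥; ⊤)
open import Data.Product using (Σ; _×_)
open import Relation.Nullary using (¬_)
open import Relation.Binary.PropositionalEquality using (_≡_)

open import Data.Bool using (Bool; true; false; not; if_then_else_)
import Data.Bool.Properties as Bool
open import Data.Fin using (Fin; zero; suc; _≟_)
import Data.Fin.Properties as Fin
open import Data.Nat as ℕ using (zero; suc; _<_; z≤n; s≤s)
open import Data.Nat.Divisibility using (_∣_; divides; ∣m+n∣m⇒∣n; m∣m*n; ∣1⇒≡1)
open import Data.Nat.Primality using (euclidsLemma; prime[2])
import Data.Nat.Properties as ℕ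
open import Algebra.Properties.Semiring.Sum ℕ.+-*-semiring
  using (sum; *-distribˡ-sum; sum-replicate-zero)
open import Data.Product using (_,_; ∃; proj₁; proj₂)
open import Data.Sum using (inj₁; inj₂; [_,_]′)
open import Data.Vec using ([]; _∷_; lookup; replicate)
open import Function using (_∘_)
open import Relation.Binary.Structures using (IsTotalOrder)
import Relation.Binary.PropositionalEquality as ≡
open ≡ using (_≢_)
open import Relation.Nullary using (yes; no; does; contradiction)

indicator : Bool → ℕ
indicator b = if b then 1 else 0

∃-lookup≡not : ∀ {n} b (K : Subset n) → K ≢ replicate n b → ∃ λ l → lookup K l ≡ not b
∃-lookup≡not b []      []≢b = contradiction ≡.refl []≢b
∃-lookup≡not b (x ∷ K) K≢b with x Bool.≟ b
... | no x≢b     = zero , Bool.¬-not x≢b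
... | yes ≡.refl with ∃-lookup≡not b K (K≢b ∘ ≡.cong (x ∷_))
...   | l , Kl≡not-b = suc l , Kl≡not-b

module NatLemmas where
  open import Data.Nat using (_+_; _*_)

  indicator≤1 : ∀ b → indicator b ≤ 1
  indicator≤1 true  = s≤s z≤n
  indicator≤1 false = z≤n

  indicator-*-≤ : ∀ b n → indicator b * n ≤ n
  indicator-*-≤ true  n = ℕ.≤-reflexive (ℕ.+-identityʳ n)
  indicator-*-≤ false n = z≤n

  sum-mono-≤ : ∀ {n} {f g : Fin n → ℕ} → (∀ l → f l ≤ g l) → sum f ≤ sum g
  sum-mono-≤ {zero}  f≤g = z≤n
  sum-mono-≤ {suc n} f≤g = ℕ.+-mono-≤ (f≤g zero) (sum-mono-≤ (f≤g ∘ suc))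

  sum-mono-< : ∀ {n} {f g : Fin n → ℕ} → (∀ l → f l ≤ g l) → ∀ {m} → f m < g m → sum f < sum g
  sum-mono-< f≤g {zero}  fm<gm = ℕ.+-mono-<-≤ fm<gm (sum-mono-≤ (f≤g ∘ suc))
  sum-mono-< f≤g {suc m} fm<gm = ℕ.+-mono-≤-< (f≤g zero) (sum-mono-< (f≤g ∘ suc) fm<gm)

  2*w≢s*n : ∀ {s w n} → ¬ 2 ∣ s → 0 < w → w < s → n ≤ 2 → 2 * w ≢ s * n
  2*w≢s*n {s} _ (s≤s _) _ z≤n eq = contradiction (≡.trans eq (ℕ.*-zeroʳ s)) λ ()
  2*w≢s*n {s} {w} s-odd _ _ (s≤s z≤n) eq =
    s-odd (divides w (≡.trans (≡.sym (ℕ.*-identityʳ s)) (≡.trans (≡.sym eq) (ℕ.*-comm 2 w))))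
  2*w≢s*n {s} {w} _ _ w<s (s≤s (s≤s z≤n)) eq =
    ℕ.<⇒≢ w<s (ℕ.*-cancelˡ-≡ w s 2 (≡.trans eq (ℕ.*-comm s 2)))

  odd*odd+even≢even : ∀ {s} x y → ¬ 2 ∣ s → s * s + 2 * x ≢ 2 * y
  odd*odd+even≢even {s} x y s-odd eq = [ s-odd , s-odd ]′ (euclidsLemma s s prime[2] 2∣s*s)
    where
    2∣2x+s*s : 2 ∣ 2 * x + s * s
    2∣2x+s*s = ≡.subst (2 ∣_) (≡.trans (≡.sym eq) (ℕ.+-comm (s * s) (2 * x))) (m∣m*n y)
    2∣s*s : 2 ∣ s * s
    2∣s*s = ∣m+n∣m⇒∣n 2∣2x+s*s (m∣m*n x)

  sides-differ-if-diagonal-term-vanishes : ∀ {s w p n} → ¬ 2 ∣ s → 0 < w → w < s → 0 < p → n ≤ 2 →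
    2 * (p * (2 * w)) ≢ 2 * (p * (s * n))
  sides-differ-if-diagonal-term-vanishes {w = w} {p} s-odd 0<w w<s 0<p n≤2 eq =
    2*w≢s*n s-odd 0<w w<s n≤2
      (ℕ.*-cancelˡ-≡ (2 * w) _ p {{ℕ.>-nonZero 0<p}} (ℕ.*-cancelˡ-≡ (p * (2 * w)) _ 2 eq))

  -- With s = ‖a‖², p = aᵢ aⱼ, w = Σ_{l ∈ K} a_l² and b the membership vector of K, the two
  -- sides are the positive and the negative part of s² (Q D_K Qᵀ)ᵢⱼ.
  cleared-sides-differ : ∀ {s w p} → ¬ 2 ∣ s → 0 < w → w < s → 0 < p →
    ∀ {n} (b : Fin n → Bool) i j →
    s * s * (indicator (b i) * indicator (does (j ≟ i))) + 2 * (p * (2 * w))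
      ≢ 2 * (p * (s * (indicator (b i) + indicator (b j))))
  cleared-sides-differ {s} {w} {p} s-odd 0<w w<s 0<p b i j with j ≟ i
  ... | no _ rewrite ℕ.*-zeroʳ (indicator (b i)) | ℕ.*-zeroʳ (s * s) =
    sides-differ-if-diagonal-term-vanishes s-odd 0<w w<s 0<p
      (ℕ.+-mono-≤ (indicator≤1 (b i)) (indicator≤1 (b j)))
  ... | yes ≡.refl with b i
  ...   | true  = odd*odd+even≢even (p * (2 * w)) (p * (s * 2)) s-odd
                ∘ ≡.trans (≡.cong (_+ 2 * (p * (2 * w))) (≡.sym (ℕ.*-identityʳ (s * s))))
  ...   | false rewrite ℕ.*-zeroʳ (s * s) =
    sides-differ-if-diagonal-term-vanishes s-odd 0<w w<s 0<p z≤n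

open NatLemmas

module RealFieldProperties {c ℓ₁ ℓ₂} (R : RealField c ℓ₁ ℓ₂) where
  open RealField R hiding (zero) renaming (_≤_ to infix 4 _≤ᵣ_)
  open IsTotalOrder isTotalOrder using (total; antisym; ≲-respˡ-≈; ≲-respʳ-≈)
    renaming (refl to ≤-refl; trans to ≤-trans)
  open import Algebra.Properties.Ring ring using (-1*x≈-x; -‿distribˡ-*; -‿distribʳ-*)
  open import Algebra.Properties.Group +-group using (⁻¹-involutive; ∙-cancelˡ; inverseˡ-unique)
  open import Algebra.Properties.Semiring.Mult.TCOptimised semiring
    using (1+×; ×-homo-+; ×1-homo-*) renaming (_×_ to _·_)
  open import Relation.Binary.Reasoning.Setoid setoid

  2# : Carrier
  2# = 1# + 1#

  x+y≈0⇒x*x≈y*y : ∀ {x y} → x + y ≈ 0# → x * x ≈ y * y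
  x+y≈0⇒x*x≈y*y {x} {y} x+y≈0 = begin
    x * x         ≈⟨ *-cong x≈-y x≈-y ⟩
    - y * - y     ≈⟨ -‿distribˡ-* y (- y) ⟨
    - (y * - y)   ≈⟨ -‿cong (-‿distribʳ-* y y) ⟨
    - (- (y * y)) ≈⟨ ⁻¹-involutive (y * y) ⟩
    y * y         ∎
    where
    x≈-y : x ≈ - y
    x≈-y = inverseˡ-unique x y x+y≈0

  0≤1 : 0# ≤ᵣ 1#
  0≤1 with total 0# 1#
  ... | inj₁ 0≤1 = 0≤1
  ... | inj₂ 1≤0 = ≲-respʳ-≈ -1*-1≈1 (*-nonneg 0≤-1 0≤-1)
    where
    0≤-1 : 0# ≤ᵣ - 1#
    0≤-1 = ≲-respˡ-≈ (-‿inverseʳ 1#) (≲-respʳ-≈ (+-identityˡ (- 1#)) (+-mono-≤ (- 1#) 1≤0))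
    -1*-1≈1 : - 1# * - 1# ≈ 1#
    -1*-1≈1 = trans (-1*x≈-x (- 1#)) (⁻¹-involutive 1#)

  +-nonneg : ∀ {x y} → 0# ≤ᵣ x → 0# ≤ᵣ y → 0# ≤ᵣ x + y
  +-nonneg {x} {y} 0≤x 0≤y = ≤-trans 0≤y (≲-respˡ-≈ (+-identityˡ y) (+-mono-≤ y 0≤x))

  nonneg-+≈0⇒≈0 : ∀ {x y} → 0# ≤ᵣ x → 0# ≤ᵣ y → x + y ≈ 0# → x ≈ 0#
  nonneg-+≈0⇒≈0 {x} {y} 0≤x 0≤y x+y≈0 = antisym x≤0 0≤x
    where
    x≤0 : x ≤ᵣ 0#
    x≤0 = ≲-respˡ-≈ (+-identityˡ x) (≲-respʳ-≈ (trans (+-comm y x) x+y≈0) (+-mono-≤ x 0≤y))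

  fromℕ : ℕ → Carrier
  fromℕ n = n · 1#

  fromℕ-nonneg : ∀ n → 0# ≤ᵣ fromℕ n
  fromℕ-nonneg zero    = ≤-refl
  fromℕ-nonneg (suc n) = ≲-respʳ-≈ (sym (1+× n 1#)) (+-nonneg 0≤1 (fromℕ-nonneg n))

  fromℕ-suc≉0 : ∀ n → ¬ fromℕ (suc n) ≈ 0#
  fromℕ-suc≉0 n eq =
    0≉1 (sym (nonneg-+≈0⇒≈0 0≤1 (fromℕ-nonneg n) (trans (sym (1+× n 1#)) eq)))

  fromℕ-injective : ∀ {m n} → fromℕ m ≈ fromℕ n → m ≡ n
  fromℕ-injective {zero}  {zero}  _  = ≡.refl
  fromℕ-injective {zero}  {suc n} eq = contradiction (sym eq) (fromℕ-suc≉0 n)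
  fromℕ-injective {suc m} {zero}  eq = contradiction eq (fromℕ-suc≉0 m)
  fromℕ-injective {suc m} {suc n} eq =
    ≡.cong suc (fromℕ-injective (∙-cancelˡ 1# _ _ (trans (sym (1+× m 1#)) (trans eq (1+× n 1#)))))

  -- m ↦ x says fromℕ m ≈ x. Being a record, it determines m, so that ↦-+ and ↦-* can assemble
  -- such facts bottom-up (fromℕ itself is not injective for unification).
  infix 4 _↦_
  record _↦_ (m : ℕ) (x : Carrier) : Set ℓ₁ where
    constructor mk↦
    field fromℕ≈ : fromℕ m ≈ x
  open _↦_ public

  ↦-fromℕ : ∀ m → m ↦ fromℕ m
  ↦-fromℕ m = mk↦ refl

  ↦-+ : ∀ {m n x y} → m ↦ x → n ↦ y → m ℕ.+ n ↦ x + y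
  ↦-+ {m} {n} (mk↦ m≈x) (mk↦ n≈y) = mk↦ (trans (×-homo-+ 1# m n) (+-cong m≈x n≈y))

  ↦-* : ∀ {m n x y} → m ↦ x → n ↦ y → m ℕ.* n ↦ x * y
  ↦-* {m} {n} (mk↦ m≈x) (mk↦ n≈y) = mk↦ (trans (×1-homo-* m n) (*-cong m≈x n≈y))

module SumProperties {c ℓ₁ ℓ₂} (R : RealField c ℓ₁ ℓ₂) where
  open RealField R hiding (zero)
  open Matrices R
  open RealFieldProperties R using (_↦_; mk↦; ↦-+)
  open import Algebra.Properties.CommutativeSemigroup +-commutativeSemigroup using (interchange)

  ∑-cong : ∀ {n} {f g : Fin n → Carrier} → (∀ l → f l ≈ g l) → ∑ f ≈ ∑ g
  ∑-cong {zero}  f≈g = refl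
  ∑-cong {suc n} f≈g = +-cong (f≈g zero) (∑-cong (f≈g ∘ suc))

  ∑-distrib-+ : ∀ {n} (f g : Fin n → Carrier) → ∑ (λ l → f l + g l) ≈ ∑ f + ∑ g
  ∑-distrib-+ {zero}  f g = sym (+-identityˡ 0#)
  ∑-distrib-+ {suc n} f g =
    trans (+-congˡ (∑-distrib-+ (f ∘ suc) (g ∘ suc))) (interchange (f zero) (g zero) _ _)

  *-distribˡ-∑ : ∀ {n} x (f : Fin n → Carrier) → x * ∑ f ≈ ∑ (λ l → x * f l)
  *-distribˡ-∑ {zero}  x f = zeroʳ x
  *-distribˡ-∑ {suc n} x f = trans (distribˡ x (f zero) _) (+-congˡ (*-distribˡ-∑ x (f ∘ suc)))

  ∑-zero : ∀ {n} {f : Fin n → Carrier} → (∀ l → f l ≈ 0#) → ∑ f ≈ 0#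
  ∑-zero {zero}  f≈0 = refl
  ∑-zero {suc n} f≈0 = trans (+-cong (f≈0 zero) (∑-zero (f≈0 ∘ suc))) (+-identityˡ 0#)

  ∑-single : ∀ {n} {f : Fin n → Carrier} i → (∀ l → l ≢ i → f l ≈ 0#) → ∑ f ≈ f i
  ∑-single zero    f≈0 = trans (+-congˡ (∑-zero (λ l → f≈0 (suc l) λ ()))) (+-identityʳ _)
  ∑-single (suc i) f≈0 = trans (+-congʳ (f≈0 zero λ ())) (trans (+-identityˡ _)
    (∑-single i λ l l≢i → f≈0 (suc l) (l≢i ∘ Fin.suc-injective)))

  ↦-∑ : ∀ {n} {f : Fin n → ℕ} {g : Fin n → Carrier} → (∀ l → f l ↦ g l) → sum f ↦ ∑ g
  ↦-∑ {zero}  f↦g = mk↦ refl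
  ↦-∑ {suc n} f↦g = ↦-+ (f↦g zero) (↦-∑ (f↦g ∘ suc))

module MatrixProperties {c ℓ₁ ℓ₂} (R : RealField c ℓ₁ ℓ₂) where
  open RealField R hiding (zero)
  open Matrices R
  open RealFieldProperties R using (fromℕ; _↦_; mk↦)
  open SumProperties R

  ‖_‖² : ∀ {n} → (Fin n → Carrier) → Carrier
  ‖ u ‖² = ∑ (λ l → u l * u l)

  I-diag : ∀ {n} (i : Fin n) → I i i ≈ 1#
  I-diag i with i ≟ i
  ... | yes _  = refl
  ... | no i≢i = contradiction ≡.refl i≢i

  I-off : ∀ {n} {i j : Fin n} → i ≢ j → I i j ≈ 0#
  I-off {i = i} {j} i≢j with i ≟ j
  ... | yes i≡j = contradiction i≡j i≢j
  ... | no _    = refl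

  I-sym : ∀ {n} (i j : Fin n) → I i j ≈ I j i
  I-sym i j with i ≟ j
  ... | yes ≡.refl = sym (I-diag i)
  ... | no i≢j     = sym (I-off (i≢j ∘ ≡.sym))

  indicator-↦-I : ∀ {n} (i j : Fin n) → indicator (does (i ≟ j)) ↦ I i j
  indicator-↦-I i j with i ≟ j
  ... | yes _ = mk↦ refl
  ... | no _  = mk↦ refl

  ∑-Iˡ : ∀ {n} (f : Fin n → Carrier) i → ∑ (λ l → I i l * f l) ≈ f i
  ∑-Iˡ f i = trans (∑-single i λ l l≢i → trans (*-congʳ (I-off (l≢i ∘ ≡.sym))) (zeroˡ (f l)))
                   (trans (*-congʳ (I-diag i)) (*-identityˡ (f i)))

  χ : ∀ {n} → Subset n → Fin n → Carrier
  χ K l = fromℕ (indicator (lookup K l))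

  D-diag : ∀ {n} (K : Subset n) j → D K j j ≈ χ K j
  D-diag K j with j ≟ j | lookup K j
  ... | yes _  | true  = refl
  ... | yes _  | false = refl
  ... | no j≢j | _     = contradiction ≡.refl j≢j

  D-off : ∀ {n} (K : Subset n) {i j} → i ≢ j → D K i j ≈ 0#
  D-off K {i} {j} i≢j with i ≟ j | lookup K i
  ... | yes i≡j | _ = contradiction i≡j i≢j
  ... | no _    | _ = refl

  ⊗-D : ∀ {n} (A : Matrix n) K i j → (A ⊗ D K) i j ≈ A i j * χ K j
  ⊗-D A K i j = trans (∑-single j λ l l≢j → trans (*-congˡ (D-off K l≢j)) (zeroʳ (A i l)))
                      (*-congˡ (D-diag K j))

  ⊗-D-⊗ᵀ : ∀ {n} (A B : Matrix n) K i j → ((A ⊗ D K) ⊗ (B ᵀ)) i j ≈ ∑ (λ l → A i l * (χ K l * B j l))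
  ⊗-D-⊗ᵀ A B K i j = ∑-cong λ l → trans (*-congʳ (⊗-D A K i l)) (*-assoc _ _ _)

module Householder {c ℓ₁ ℓ₂} (R : RealField c ℓ₁ ℓ₂)
                   {n} (a : Fin n → RealField.Carrier R) (σ : RealField.Carrier R) where
  open RealField R hiding (zero)
  open Matrices R
  open SumProperties R
  open MatrixProperties R
  open RealFieldProperties R using (2#; x+y≈0⇒x*x≈y*y)
  open import Algebra.Solver.Ring.NaturalCoefficients.Default commutativeSemiring
  open import Relation.Binary.Reasoning.Setoid setoid

  H : Matrix n
  H i j = I i j + σ * (a i * a j)

  H-sym : ∀ i j → H i j ≈ H j i
  H-sym i j = +-cong (I-sym i j) (*-congˡ (*-comm (a i) (a j)))

  H-action : ∀ (f : Fin n → Carrier) i → ∑ (λ l → H i l * f l) ≈ f i + σ * (a i * ∑ (λ l → f l * a l))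
  H-action f i = begin
    ∑ (λ l → H i l * f l)
      ≈⟨ ∑-cong (λ l → expand (I i l) (a l) (f l)) ⟩
    ∑ (λ l → I i l * f l + σ * a i * (f l * a l))
      ≈⟨ ∑-distrib-+ (λ l → I i l * f l) (λ l → σ * a i * (f l * a l)) ⟩
    ∑ (λ l → I i l * f l) + ∑ (λ l → σ * a i * (f l * a l))
      ≈⟨ +-cong (∑-Iˡ f i) (sym (*-distribˡ-∑ (σ * a i) (λ l → f l * a l))) ⟩
    f i + σ * a i * ∑ (λ l → f l * a l)
      ≈⟨ +-congˡ (*-assoc σ (a i) _) ⟩
    f i + σ * (a i * ∑ (λ l → f l * a l)) ∎
    where
    expand : ∀ δ al fl → (δ + σ * (a i * al)) * fl ≈ δ * fl + σ * a i * (fl * al)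
    expand δ al fl =
      solve 5 (λ δ s ai al fl → (δ :+ s :* (ai :* al)) :* fl := δ :* fl :+ s :* ai :* (fl :* al))
            refl δ σ (a i) al fl

  H-orthogonal : σ * ‖ a ‖² + 2# ≈ 0# → Orthogonal H
  H-orthogonal σ‖a‖²+2≈0 i j = begin
    ∑ (λ l → H l i * H l j)                        ≈⟨ ∑-cong (λ l → *-congʳ (H-sym l i)) ⟩
    ∑ (λ l → H i l * H l j)                        ≈⟨ H-action (λ l → H l j) i ⟩
    H i j + σ * (a i * ∑ (λ l → H l j * a l))      ≈⟨ +-congˡ (*-congˡ (*-congˡ column)) ⟩
    H i j + σ * (a i * (a j + σ * (a j * S)))      ≈⟨ regroup (I i j) (a i) (a j) ⟩
    I i j + σ * (a i * a j) * (σ * S + 2#)         ≈⟨ +-congˡ (trans (*-congˡ σ‖a‖²+2≈0) (zeroʳ _)) ⟩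
    I i j + 0#                                     ≈⟨ +-identityʳ (I i j) ⟩
    I i j                                          ∎
    where
    S = ‖ a ‖²
    column : ∑ (λ l → H l j * a l) ≈ a j + σ * (a j * S)
    column = trans (∑-cong (λ l → *-congʳ (H-sym l j))) (H-action a j)
    regroup : ∀ δ ai aj → δ + σ * (ai * aj) + σ * (ai * (aj + σ * (aj * S)))
                          ≈ δ + σ * (ai * aj) * (σ * S + 2#)
    regroup δ ai aj = solve 5 (λ δ s ai aj S → δ :+ s :* (ai :* aj) :+ s :* (ai :* (aj :+ s :* (aj :* S)))
                                             := δ :+ s :* (ai :* aj) :* (s :* S :+ con 2))
                            refl δ σ ai aj S

  H-conj-diagonal : ∀ (d : Fin n → Carrier) i j →
    ∑ (λ l → H i l * (d l * H j l))
      ≈ d i * H j i + σ * (a i * (d j * a j + σ * (a j * ∑ (λ l → d l * (a l * a l)))))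
  H-conj-diagonal d i j = begin
    ∑ (λ l → H i l * (d l * H j l))                       ≈⟨ H-action (λ l → d l * H j l) i ⟩
    d i * H j i + σ * (a i * ∑ (λ l → d l * H j l * a l)) ≈⟨ +-congˡ (*-congˡ (*-congˡ row)) ⟩
    d i * H j i + σ * (a i * (d j * a j + σ * (a j * W))) ∎
    where
    W = ∑ (λ l → d l * (a l * a l))
    row : ∑ (λ l → d l * H j l * a l) ≈ d j * a j + σ * (a j * W)
    row = begin
      ∑ (λ l → d l * H j l * a l)
        ≈⟨ ∑-cong (λ l → solve 3 (λ dl h al → dl :* h :* al := h :* (dl :* al)) refl (d l) (H j l) (a l)) ⟩
      ∑ (λ l → H j l * (d l * a l))
        ≈⟨ H-action (λ l → d l * a l) j ⟩
      d j * a j + σ * (a j * ∑ (λ l → d l * a l * a l))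
        ≈⟨ +-congˡ (*-congˡ (*-congˡ (∑-cong (λ l → *-assoc (d l) (a l) (a l))))) ⟩
      d j * a j + σ * (a j * W) ∎

  -- Multiplying by ‖a‖⁴ clears the denominator of σ = -2/‖a‖².
  H-conj-diagonal-cleared : σ * ‖ a ‖² + 2# ≈ 0# → ∀ (d : Fin n → Carrier) i j →
    ‖ a ‖² * ‖ a ‖² * ∑ (λ l → H i l * (d l * H j l)) + 2# * (a i * a j * (‖ a ‖² * (d i + d j)))
      ≈ ‖ a ‖² * ‖ a ‖² * (d i * I j i) + 2# * (a i * a j * (2# * ∑ (λ l → d l * (a l * a l))))
  H-conj-diagonal-cleared σ‖a‖²+2≈0 d i j = begin
    S * S * ∑ (λ l → H i l * (d l * H j l)) + 2# * (a i * a j * (S * (d i + d j)))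
      ≈⟨ +-congʳ (*-congˡ (H-conj-diagonal d i j)) ⟩
    S * S * (d i * H j i + σ * (a i * (d j * a j + σ * (a j * W)))) + 2# * (a i * a j * (S * (d i + d j)))
      ≈⟨ regroup (d i) (d j) (I j i) (a i) (a j) W ⟩
    S * S * (d i * I j i) + S * (a i * a j) * (d i + d j) * (σ * S + 2#) + σ * S * (σ * S) * (a i * a j * W)
      ≈⟨ +-cong (+-congˡ (trans (*-congˡ σ‖a‖²+2≈0) (zeroʳ _))) (*-congʳ (x+y≈0⇒x*x≈y*y σ‖a‖²+2≈0)) ⟩
    S * S * (d i * I j i) + 0# + 2# * 2# * (a i * a j * W)
      ≈⟨ +-cong (+-identityʳ _) (regroup′ (a i * a j) W) ⟩
    S * S * (d i * I j i) + 2# * (a i * a j * (2# * W)) ∎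
    where
    S = ‖ a ‖²
    W = ∑ (λ l → d l * (a l * a l))
    regroup : ∀ di dj δ ai aj w →
      S * S * (di * (δ + σ * (aj * ai)) + σ * (ai * (dj * aj + σ * (aj * w)))) + 2# * (ai * aj * (S * (di + dj)))
        ≈ S * S * (di * δ) + S * (ai * aj) * (di + dj) * (σ * S + 2#) + σ * S * (σ * S) * (ai * aj * w)
    regroup di dj δ ai aj w = solve 8
      (λ S s di dj δ ai aj w →
         S :* S :* (di :* (δ :+ s :* (aj :* ai)) :+ s :* (ai :* (dj :* aj :+ s :* (aj :* w))))
           :+ con 2 :* (ai :* aj :* (S :* (di :+ dj)))
         := S :* S :* (di :* δ) :+ S :* (ai :* aj) :* (di :+ dj) :* (s :* S :+ con 2)
              :+ s :* S :* (s :* S) :* (ai :* aj :* w))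
      refl S σ di dj δ ai aj w
    regroup′ : ∀ x w → 2# * 2# * (x * w) ≈ 2# * (x * (2# * w))
    regroup′ x w = solve 2 (λ x w → con 2 :* con 2 :* (x :* w) := con 2 :* (x :* (con 2 :* w))) refl x w

module Construction {c ℓ₁ ℓ₂} (R : RealField c ℓ₁ ℓ₂) (k : ℕ) where
  open RealField R hiding (zero)
  open Matrices R
  open RealFieldProperties R
  open MatrixProperties R
  open SumProperties R using (↦-∑)
  open import Algebra.Properties.Ring ring using (-‿distribˡ-*)
  open import Relation.Binary.Reasoning.Setoid setoid

  v : Fin (suc k) → ℕ
  v zero    = 1
  v (suc _) = 2

  v² : Fin (suc k) → ℕ
  v² l = v l ℕ.* v l

  s : ℕ
  s = sum v²

  weight : Subset (suc k) → ℕ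
  weight K = sum (λ l → indicator (lookup K l) ℕ.* v² l)

  s-odd : ¬ 2 ∣ s
  s-odd 2∣s = contradiction (∣1⇒≡1 (∣m+n∣m⇒∣n 2∣2m+1 (m∣m*n m))) λ ()
    where
    m = sum (λ (_ : Fin k) → 2)
    s≡2m+1 : s ≡ 2 ℕ.* m ℕ.+ 1
    s≡2m+1 = ≡.trans (≡.cong suc (≡.sym (*-distribˡ-sum 2 (λ (_ : Fin k) → 2)))) (ℕ.+-comm 1 _)
    2∣2m+1 : 2 ∣ 2 ℕ.* m ℕ.+ 1
    2∣2m+1 = ≡.subst (2 ∣_) s≡2m+1 2∣s

  0<v*v : ∀ i j → 0 < v i ℕ.* v j
  0<v*v zero    zero    = s≤s z≤n
  0<v*v zero    (suc _) = s≤s z≤n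
  0<v*v (suc _) zero    = s≤s z≤n
  0<v*v (suc _) (suc _) = s≤s z≤n

  0<weight : ∀ K → K ≢ ⊥ → 0 < weight K
  0<weight K K≢⊥ with ∃-lookup≡not false K K≢⊥
  ... | l , Kl≡true = ≡.subst (_< weight K) (sum-replicate-zero (suc k))
                        (sum-mono-< {g = λ l → indicator (lookup K l) ℕ.* v² l} (λ _ → z≤n) {l} 0<term)
    where
    0<term : 0 < indicator (lookup K l) ℕ.* v² l
    0<term rewrite Kl≡true = ℕ.<-≤-trans (0<v*v l l) (ℕ.m≤m+n (v² l) 0)

  weight<s : ∀ K → K ≢ ⊤ → weight K < s
  weight<s K K≢⊤ with ∃-lookup≡not true K K≢⊤
  ... | l , Kl≡false = sum-mono-< {f = λ l → indicator (lookup K l) ℕ.* v² l} {g = v²}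
                         (λ l → indicator-*-≤ (lookup K l) (v² l)) {l} term<v²
    where
    term<v² : indicator (lookup K l) ℕ.* v² l < v² l
    term<v² rewrite Kl≡false = 0<v*v l l

  a : Fin (suc k) → Carrier
  a l = fromℕ (v l)

  v²-↦ : ∀ l → v² l ↦ a l * a l
  v²-↦ l = ↦-* (↦-fromℕ (v l)) (↦-fromℕ (v l))

  s-↦ : s ↦ ‖ a ‖²
  s-↦ = ↦-∑ v²-↦

  weight-↦ : ∀ K → weight K ↦ ∑ (λ l → χ K l * (a l * a l))
  weight-↦ K = ↦-∑ (λ l → ↦-* (↦-fromℕ (indicator (lookup K l))) (v²-↦ l))

  ‖a‖²≉0 : ¬ ‖ a ‖² ≈ 0#
  ‖a‖²≉0 ‖a‖²≈0 = contradiction (fromℕ-injective {s} {0} (trans (fromℕ≈ s-↦) ‖a‖²≈0)) λ ()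

  σ : Carrier
  σ = - (2# * proj₁ (inverse ‖ a ‖² ‖a‖²≉0))

  σ‖a‖²+2≈0 : σ * ‖ a ‖² + 2# ≈ 0#
  σ‖a‖²+2≈0 = begin
    - (2# * t) * S + 2#   ≈⟨ +-congʳ (-‿distribˡ-* (2# * t) S) ⟨
    - (2# * t * S) + 2#   ≈⟨ +-congʳ (-‿cong (*-assoc 2# t S)) ⟩
    - (2# * (t * S)) + 2# ≈⟨ +-congʳ (-‿cong (*-congˡ (trans (*-comm t S) (proj₂ (inverse S ‖a‖²≉0))))) ⟩
    - (2# * 1#) + 2#      ≈⟨ +-congʳ (-‿cong (*-identityʳ 2#)) ⟩
    - 2# + 2#             ≈⟨ -‿inverseˡ 2# ⟩
    0#                    ∎
    where
    S = ‖ a ‖²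
    t = proj₁ (inverse S ‖a‖²≉0)

  open Householder R a σ public using (H; H-orthogonal)
  open Householder R a σ using (H-conj-diagonal-cleared)

  conj-entry≈0⇒cleared-sides-equal : ∀ K i j → ((H ⊗ D K) ⊗ (H ᵀ)) i j ≈ 0# →
    s ℕ.* s ℕ.* (indicator (lookup K i) ℕ.* indicator (does (j ≟ i))) ℕ.+ 2 ℕ.* (v i ℕ.* v j ℕ.* (2 ℕ.* weight K))
      ≡ 2 ℕ.* (v i ℕ.* v j ℕ.* (s ℕ.* (indicator (lookup K i) ℕ.+ indicator (lookup K j))))
  conj-entry≈0⇒cleared-sides-equal K i j entry≈0 =
    fromℕ-injective (trans (fromℕ≈ lhs↦) (trans (sym cleared) (trans vanishing (sym (fromℕ≈ rhs↦)))))
    where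
    S = ‖ a ‖²
    cleared = H-conj-diagonal-cleared σ‖a‖²+2≈0 (χ K) i j
    lhs↦ = ↦-+ (↦-* (↦-* s-↦ s-↦) (↦-* (↦-fromℕ (indicator (lookup K i))) (indicator-↦-I j i)))
               (↦-* (↦-fromℕ 2) (↦-* (↦-* (↦-fromℕ (v i)) (↦-fromℕ (v j))) (↦-* (↦-fromℕ 2) (weight-↦ K))))
    rhs↦ = ↦-* (↦-fromℕ 2) (↦-* (↦-* (↦-fromℕ (v i)) (↦-fromℕ (v j)))
                 (↦-* s-↦ (↦-+ (↦-fromℕ (indicator (lookup K i))) (↦-fromℕ (indicator (lookup K j))))))
    vanishing : S * S * ∑ (λ l → H i l * (χ K l * H j l)) + 2# * (a i * a j * (S * (χ K i + χ K j)))
                ≈ 2# * (a i * a j * (S * (χ K i + χ K j)))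
    vanishing =
      trans (+-congʳ (trans (*-congˡ (trans (sym (⊗-D-⊗ᵀ H H K i j)) entry≈0)) (zeroʳ _))) (+-identityˡ _)

  conj-entry≉0 : ∀ K → ¬ K ≡ ⊥ → ¬ K ≡ ⊤ → ∀ i j → ¬ ((H ⊗ D K) ⊗ (H ᵀ)) i j ≈ 0#
  conj-entry≉0 K K≢⊥ K≢⊤ i j =
    cleared-sides-differ s-odd (0<weight K K≢⊥) (weight<s K K≢⊤) (0<v*v i j) (lookup K) i j
    ∘ conj-entry≈0⇒cleared-sides-equal K i j

lemma2p3 : (ℝ : RealField 0ℓ 0ℓ 0ℓ) → (k : ℕ) → 1 ≤ k →
           Σ (Matrices.Matrix ℝ k) λ Q → Matrices.Orthogonal ℝ Q ×
             ((K : Subset k) → ¬ (K ≡ ⊥) → ¬ (K ≡ ⊤) →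
               ∀ i j → ¬ (RealField._≈_ ℝ
                 (Matrices._⊗_ ℝ (Matrices._⊗_ ℝ Q (Matrices.D ℝ K)) (Matrices._ᵀ ℝ Q) i j)
                 (RealField.0# ℝ)))
lemma2p3 ℝ (suc k) _ = H , H-orthogonal σ‖a‖²+2≈0 , conj-entry≉0
  where open Construction ℝ k
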